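{- Let $\mathcal{F}_1 = \dots = \mathcal{F}_k$ be families and $t\in\mathbb{N}$. (i) If $(\mathcal{F}_1, \dots, \mathcal{F}_k)$ has the cross-$t$-star property, then it has the strong cross-$t$-star property. (ii) If $(\mathcal{F}_1, \dots, \mathcal{F}_k)$ has the strict cross-$t$-star property, then it has the extrastrong cross-$t$-star property.
   Context: All sets and families are finite. Families $\mathcal{A}_1,\dots,\mathcal{A}_k$ are cross-$t$-intersecting if for all distinct $i,j$ each set of $\mathcal{A}_i$ shares at least $t$ elements with each set of $\mathcal{A}_j$. The tuple $(\mathcal{A}_1,\dots,\mathcal{A}_k)$ is below $(\mathcal{F}_1,\dots,\mathcal{F}_k)$ if $\mathcal{A}_i\subseteq\mathcal{F}_i$ for all $i$. $\mathcal{F}(T)=\{F\in\mathcal{F}:T\subseteq F\}$ and $l(\mathcal{F},t)=\max_{|T|=t}|\mathcal{F}(T)|$. $(\mathcal{F}_1,\dots,\mathcal{F}_k)$ has the: (a) cross-$t$-star property if $\prod|\mathcal{A}_i|\leq\prod l(\mathcal{F}_i,t)$ for every cross-$t$-intersecting tuple below it; (b) strict cross-$t$-star property if moreover the inequality is strict whenever there is no $t$-set $T$ with $\mathcal{A}_i=\mathcal{F}_i(T)$ for all $i$; (c) strong cross-$t$-star property if there is a $t$-set $T$ such that $\prod|\mathcal{A}_i|\leq\prod|\mathcal{F}_i(T)|$ for every cross-$t$-intersecting tuple below it; (d) extrastrong cross-$t$-star property if there is a $t$-set $T$ such that for every cross-$t$-intersecting tuple below it, $\prod|\mathcal{A}_i|\leq\prod|\mathcal{F}_i(T)|$,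 with equality only if there is a $t$-set $T'$ with $\mathcal{A}_i=\mathcal{F}_i(T')$ for all $i$. -}

module Defs where

open import Data.Nat using (ℕ; zero; suc; _≤_; _<_; _⊔_)
open import Data.Nat.Properties using (_≟_)
open import Data.Fin using (Fin) renaming (zero to fzero; suc to fsuc)
open import Data.Fin.Subset using (Subset; _⊆_; _∩_; ∣_∣; inside; outside)
open import Data.Fin.Subset.Properties using (_⊆?_)
open import Data.Vec using (_∷_; [])
open import Data.List using (List; []; _∷_; map; filter; length; foldr; _++_)
open import Data.List.Membership.Propositional using (_∈_)
open import Data.List.Relation.Unary.All using (All)
open import Data.List.Relation.Unary.Unique.Propositional using (Unique)
open import Data.Product using (Σ; _×_; ∃-syntax)
open import Relation.Nullary using (¬_)
open import Relation.Binary.PropositionalEquality using (_≡_)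
open import Data.Nat using (_*_)

-- Ground set is Fin n; a "set" is a Subset n; a (finite) family of sets is
-- a duplicate-free list of subsets, its cardinality being the list length.

Family : ℕ → Set
Family n = List (Subset n)

IsFamily : ∀ {n} → Family n → Set
IsFamily 𝓐 = Unique 𝓐

allSubsets : (n : ℕ) → List (Subset n)
allSubsets zero = [] ∷ []
allSubsets (suc n) = map (outside ∷_) (allSubsets n) ++ map (inside ∷_) (allSubsets n)

tSubsets : (n t : ℕ) → List (Subset n)
tSubsets n t = filter (λ T → ∣ T ∣ ≟ t) (allSubsets n)

star : ∀ {n} → Family n → Subset n → Family n
star 𝓕 T = filter (T ⊆?_) 𝓕

ell : ∀ {n} → Family n → ℕ → ℕ
ell {n} 𝓕 t = foldr _⊔_ 0 (map (λ T → length (star 𝓕 T)) (tSubsets n t))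

prod : (k : ℕ) → (Fin k → ℕ) → ℕ
prod zero f = 1
prod (suc k) f = f fzero * prod k (λ i → f (fsuc i))

_≐_ : ∀ {n} → Family n → Family n → Set
𝓐 ≐ 𝓑 = ∀ S → (S ∈ 𝓐 → S ∈ 𝓑) × (S ∈ 𝓑 → S ∈ 𝓐)

CrossIntersecting : ∀ {n k} → ℕ → (Fin k → Family n) → Set
CrossIntersecting {k = k} t 𝓐 =
  ∀ (i j : Fin k) → ¬ (i ≡ j) → ∀ A B → A ∈ 𝓐 i → B ∈ 𝓐 j → t ≤ ∣ A ∩ B ∣

Below : ∀ {n k} → (Fin k → Family n) → (Fin k → Family n) → Set
Below {k = k} 𝓐 𝓕 = ∀ (i : Fin k) → IsFamily (𝓐 i) × All (_∈ 𝓕 i) (𝓐 i)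

∏∣_∣ : ∀ {n k} → (Fin k → Family n) → ℕ
∏∣_∣ {k = k} 𝓐 = prod k (λ i → length (𝓐 i))

starTuple : ∀ {n k} → (Fin k → Family n) → Subset n → Fin k → Family n
starTuple 𝓕 T i = star (𝓕 i) T

IsStarTuple : ∀ {n k} → ℕ → (Fin k → Family n) → (Fin k → Family n) → Set
IsStarTuple {n} t 𝓐 𝓕 = ∃[ T ] (∣ T ∣ ≡ t) × (∀ i → 𝓐 i ≐ star (𝓕 i) T)

CrossStar : ∀ {n k} → ℕ → (Fin k → Family n) → Set
CrossStar {n} {k} t 𝓕 = ∀ (𝓐 : Fin k → Family n) → Below 𝓐 𝓕 → CrossIntersecting t 𝓐 →
  ∏∣ 𝓐 ∣ ≤ prod k (λ i → ell (𝓕 i) t)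

StrictCrossStar : ∀ {n k} → ℕ → (Fin k → Family n) → Set
StrictCrossStar {n} {k} t 𝓕 = CrossStar t 𝓕 ×
  (∀ (𝓐 : Fin k → Family n) → Below 𝓐 𝓕 → CrossIntersecting t 𝓐 →
     ¬ IsStarTuple t 𝓐 𝓕 → ∏∣ 𝓐 ∣ < prod k (λ i → ell (𝓕 i) t))

StrongCrossStar : ∀ {n k} → ℕ → (Fin k → Family n) → Set
StrongCrossStar {n} {k} t 𝓕 = ∃[ T ] (∣ T ∣ ≡ t) ×
  (∀ (𝓐 : Fin k → Family n) → Below 𝓐 𝓕 → CrossIntersecting t 𝓐 →
     ∏∣ 𝓐 ∣ ≤ ∏∣ starTuple 𝓕 T ∣)

ExtrastrongCrossStar : ∀ {n k} → ℕ → (Fin k → Family n) → Set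
ExtrastrongCrossStar {n} {k} t 𝓕 = ∃[ T ] (∣ T ∣ ≡ t) ×
  (∀ (𝓐 : Fin k → Family n) → Below 𝓐 𝓕 → CrossIntersecting t 𝓐 →
     (∏∣ 𝓐 ∣ ≤ ∏∣ starTuple 𝓕 T ∣) ×
     (∏∣ 𝓐 ∣ ≡ ∏∣ starTuple 𝓕 T ∣ → IsStarTuple t 𝓐 𝓕))

-- All the families coincide, so a single t-set T maximising
-- |𝓕(T)| realises l(𝓕ᵢ, t) for every i simultaneously, and then
-- ∏ l(𝓕ᵢ, t) ≤ ∏ |𝓕ᵢ(T)|: the cross-t-star bound becomes a strong one
-- with centre T. In the strict case, equality with ∏ |𝓕ᵢ(T)| rules out
-- the strict inequality, so the tuple must be a star tuple (decidability
-- of being a star tuple makes this argument constructive).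
module Submission where

open import Defs
open import Data.Nat using (ℕ; zero; suc; _≤_; _⊔_; z≤n; s≤s)
open import Data.Nat.Properties using (_≟_; ≤-refl; ≤-trans; *-mono-≤; ⊔-lub; <-≤-trans; <-irrefl)
open import Data.Fin using (Fin) renaming (zero to fzero; suc to fsuc)
import Data.Fin.Properties as Fin
open import Data.Fin.Subset using (Subset; ∣_∣; inside; ⊥)
open import Data.Fin.Subset.Properties using (∣⊥∣≡0; anySubset?)
open import Data.Vec using (_∷_)
open import Data.Vec.Properties using (≡-dec)
import Data.Bool.Properties as Bool
open import Data.List using (List; []; _∷_; map; foldr; length)
open import Data.List.Relation.Unary.All using (All; []; _∷_)
open import Data.List.Relation.Unary.All.Properties using (all-filter)
open import Data.List.Extrema.Nat using (argmax; argmax-all; f[xs]≤f[argmax])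
import Data.List.Relation.Binary.Subset.DecPropositional as ListSubset
open import Data.Product using (_×_; _,_; proj₁; proj₂; ∃-syntax; Σ-syntax)
open import Relation.Nullary using (Dec)
open import Relation.Nullary.Decidable using (map′; _×-dec_; decidable-stable)
open import Relation.Binary.PropositionalEquality using (_≡_; cong)

subset-of-size : ∀ {n} t → t ≤ n → Σ[ T ∈ Subset n ] ∣ T ∣ ≡ t
subset-of-size {n}     zero    _       = ⊥ , ∣⊥∣≡0 n
subset-of-size {suc n} (suc t) (s≤s p) with subset-of-size {n} t p
... | T , ∣T∣≡t = inside ∷ T , cong suc ∣T∣≡t

foldr-⊔-map-lub : ∀ {A : Set} {f : A → ℕ} {v} xs →
  All (λ x → f x ≤ v) xs → foldr _⊔_ 0 (map f xs) ≤ v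
foldr-⊔-map-lub []       []           = z≤n
foldr-⊔-map-lub (x ∷ xs) (fx≤v ∷ xs≤v) = ⊔-lub fx≤v (foldr-⊔-map-lub xs xs≤v)

prod-mono-≤ : ∀ k {f g : Fin k → ℕ} → (∀ i → f i ≤ g i) → prod k f ≤ prod k g
prod-mono-≤ zero    f≤g = ≤-refl
prod-mono-≤ (suc k) f≤g = *-mono-≤ (f≤g fzero) (prod-mono-≤ k (λ i → f≤g (fsuc i)))

≐? : ∀ {n} (𝓐 𝓑 : Family n) → Dec (𝓐 ≐ 𝓑)
≐? 𝓐 𝓑 = map′
  (λ (𝓐⊆𝓑 , 𝓑⊆𝓐) S → 𝓐⊆𝓑 {S} , 𝓑⊆𝓐 {S})
  (λ 𝓐≐𝓑 → (λ {S} → let to , _ = 𝓐≐𝓑 S in to) , (λ {S} → let _ , from = 𝓐≐𝓑 S in from))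
  ((𝓐 ⊆? 𝓑) ×-dec (𝓑 ⊆? 𝓐))
    where open ListSubset (≡-dec Bool._≟_)

isStarTuple? : ∀ {n k} t (𝓐 𝓕 : Fin k → Family n) → Dec (IsStarTuple t 𝓐 𝓕)
isStarTuple? t 𝓐 𝓕 = anySubset? (λ S → (∣ S ∣ ≟ t) ×-dec Fin.all? (λ i → ≐? (𝓐 i) (star (𝓕 i) S)))

CommonMaximiser : ∀ {n k} → ℕ → (Fin k → Family n) → Subset n → Set
CommonMaximiser t 𝓕 T = ∣ T ∣ ≡ t × (∀ i → ell (𝓕 i) t ≤ length (star (𝓕 i) T))

commonMaximiser-const : ∀ {n k} t → t ≤ n → (𝓕 : Family n) →
  ∃[ T ] CommonMaximiser t (λ (_ : Fin k) → 𝓕) T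
commonMaximiser-const {n} t t≤n 𝓕 with subset-of-size t t≤n
... | T₀ , ∣T₀∣≡t = T , ∣T∣≡t , λ _ → foldr-⊔-map-lub candidates (f[xs]≤f[argmax] T₀ candidates)
  where
  size : Subset n → ℕ
  size S = length (star 𝓕 S)

  candidates : List (Subset n)
  candidates = tSubsets n t

  T : Subset n
  T = argmax size T₀ candidates

  ∣T∣≡t : ∣ T ∣ ≡ t
  ∣T∣≡t = argmax-all size ∣T₀∣≡t (all-filter (λ S → ∣ S ∣ ≟ t) (allSubsets n))

module _ {n k t} {𝓕 : Fin k → Family n} {T : Subset n} (maximiser : CommonMaximiser t 𝓕 T) where

  private
    ∏ell≤∏star : prod k (λ i → ell (𝓕 i) t) ≤ ∏∣ starTuple 𝓕 T ∣
    ∏ell≤∏star = prod-mono-≤ k (proj₂ maximiser)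

  crossStar⇒strongCrossStar : CrossStar t 𝓕 → StrongCrossStar t 𝓕
  crossStar⇒strongCrossStar cs =
    T , proj₁ maximiser , λ 𝓐 below cross → ≤-trans (cs 𝓐 below cross) ∏ell≤∏star

  strictCrossStar⇒extrastrongCrossStar : StrictCrossStar t 𝓕 → ExtrastrongCrossStar t 𝓕
  strictCrossStar⇒extrastrongCrossStar (cs , strict) =
    T , proj₁ maximiser , λ 𝓐 below cross →
      ≤-trans (cs 𝓐 below cross) ∏ell≤∏star ,
      λ ∏≡ → decidable-stable (isStarTuple? t 𝓐 𝓕)
        (λ notStar → <-irrefl ∏≡ (<-≤-trans (strict 𝓐 below cross notStar) ∏ell≤∏star))

proposition2p3 : (n k t : ℕ) → t ≤ n → (𝓕 : Family n) → IsFamily 𝓕 →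
    (CrossStar t (λ (_ : Fin k) → 𝓕) → StrongCrossStar t (λ (_ : Fin k) → 𝓕)) ×
    (StrictCrossStar t (λ (_ : Fin k) → 𝓕) → ExtrastrongCrossStar t (λ (_ : Fin k) → 𝓕))
proposition2p3 n k t t≤n 𝓕 _ =
  let _ , maximiser = commonMaximiser-const {k = k} t t≤n 𝓕 in
  crossStar⇒strongCrossStar maximiser , strictCrossStar⇒extrastrongCrossStar maximiser
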